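{- For every integer $k\in\mathbb{Z}$, every integer $r\geq 0$ and every integer $n\geq 0$, $$B_{n}^{(k)}(x)=\sum_{m=0}^{n}\left\{\binom{n}{m}\sum_{l=0}^{n-m}\frac{r!\,(n-m)_{l}}{(l+r)!}S_{2}(l+r,r)B_{n-l-m}^{(k)}\right\}\mathbb{B}_{m}^{(r)}(x).$$
   Context: For $k\in\mathbb{Z}$, the polylogarithm is $Li_k(x)=\sum_{m=1}^{\infty}\frac{x^m}{m^k}$. The poly-Bernoulli polynomials $B_n^{(k)}(x)$ are defined by the generating function (an identity of formal power series in $t$) $$\frac{Li_{k}(1-e^{ -t})}{1-e^{ -t}}e^{xt}=\sum_{n=0}^{\infty}B_{n}^{(k)}(x)\frac{t^{n}}{n!},$$ and $B_n^{(k)}=B_n^{(k)}(0)$ are the poly-Bernoulli numbers. The Bernoulli polynomials of order $r$ are defined by $\left(\frac{t}{e^t-1}\right)^r e^{xt}=\sum_{n=0}^\infty \mathbb{B}_n^{(r)}(x)\frac{t^n}{n!}$. $S_2(l,m)$ denotes the Stirling numbers of the second kind, defined by $(e^t-1)^m=m!\sum_{l=m}^\infty S_2(l,m)\frac{t^l}{l!}$. $(a)_l=a(a-1)\cdots(a-l+1)$ is the falling factorial, with $(a)_0=1$. -}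

module Defs where

open import Data.Nat as ℕ using (ℕ; zero; suc; _∸_)
open import Data.Nat.Properties using (_!≢0; m^n≢0)
open import Data.Integer as ℤ using (ℤ; +_; -[1+_])
open import Data.Rational using (ℚ; _/_; _+_; _*_; -_; 0ℚ; 1ℚ)

ℕ→ℚ : ℕ → ℚ
ℕ→ℚ n = + n / 1

_^ℚ_ : ℚ → ℕ → ℚ
q ^ℚ zero  = 1ℚ
q ^ℚ suc n = q * (q ^ℚ n)

inv! : ℕ → ℚ
inv! n = + 1 / (n ℕ.!)
  where instance _ = n !≢0

Σ≤ : ℕ → (ℕ → ℚ) → ℚ
Σ≤ zero    f = f 0
Σ≤ (suc n) f = Σ≤ n f + f (suc n)

-- formal power series in t over ℚ: f n = coefficient of t^n
Series : Set
Series = ℕ → ℚ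

oneS : Series
oneS zero    = 1ℚ
oneS (suc _) = 0ℚ

_⊕_ : Series → Series → Series
(f ⊕ g) n = f n + g n

⊖_ : Series → Series
(⊖ f) n = - f n

_⊛_ : Series → Series → Series
(f ⊛ g) n = Σ≤ n (λ i → f i * g (n ∸ i))

_^S_ : Series → ℕ → Series
f ^S zero  = oneS
f ^S suc j = f ⊛ (f ^S j)

expS : ℚ → Series
expS a n = (a ^ℚ n) * inv! n

-- multiplicative inverse of a series with constant term 1:
-- invRev f n is the vector (g_n , g_{n-1}, ... , g_0) (as a list, head = g_n)
open import Data.List using (List; []; _∷_)

private
  lookupD : List ℚ → ℕ → ℚ
  lookupD []       _       = 0ℚ
  lookupD (x ∷ _)  zero    = x
  lookupD (_ ∷ xs) (suc i) = lookupD xs i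

invRev : Series → ℕ → List ℚ
invRev f zero    = 1ℚ ∷ []
invRev f (suc n) = (- Σ≤ n (λ i → f (suc i) * lookupD prev i)) ∷ prev
  where prev = invRev f n

-- the inverse series g with f ⊛ g = 1 (assuming f 0 = 1)
inv1S : Series → Series
inv1S f zero    = 1ℚ
inv1S f (suc n) with invRev f (suc n)
... | g ∷ _ = g
... | []    = 0ℚ

oneMinusExpNeg : Series
oneMinusExpNeg = oneS ⊕ (⊖ expS (- 1ℚ))

-- 1 / m^k  for m ≥ 1 and k ∈ ℤ   (m = suc j)
invPowZ : ℕ → ℤ → ℚ
invPowZ j (+ n)    = + 1 / (suc j ℕ.^ n)
  where instance _ = m^n≢0 (suc j) n
invPowZ j -[1+ n ] = ℕ→ℚ (suc j ℕ.^ suc n)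

-- Li_k(1-e^{-t}) / (1-e^{-t}) = Σ_{m≥1} (1-e^{-t})^{m-1} / m^k  (as a formal power series).
-- Since (1-e^{-t})^{j} has no terms below t^j, the coefficient of t^n only involves j ≤ n.
polyLiQuot : ℤ → Series
polyLiQuot k n = Σ≤ n (λ j → invPowZ j k * ((oneMinusExpNeg ^S j) n))

-- poly-Bernoulli polynomials B_n^{(k)}(x) = n! [t^n] (Li_k(1-e^{-t})/(1-e^{-t})) e^{xt}
polyBernoulliPoly : ℤ → ℕ → ℚ → ℚ
polyBernoulliPoly k n x = ℕ→ℚ (n ℕ.!) * (polyLiQuot k ⊛ expS x) n

polyBernoulli : ℤ → ℕ → ℚ
polyBernoulli k n = polyBernoulliPoly k n 0ℚ

expMinusOne : Series
expMinusOne = expS 1ℚ ⊕ (⊖ oneS)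

expMinusOneOverT : Series
expMinusOneOverT n = expMinusOne (suc n)

tOverExpMinusOne : Series
tOverExpMinusOne = inv1S expMinusOneOverT

-- Bernoulli polynomials of order r:  (t/(e^t-1))^r e^{xt} = Σ 𝔹_n^{(r)}(x) t^n/n!
bernoulliPolyOrder : ℕ → ℕ → ℚ → ℚ
bernoulliPolyOrder r n x = ℕ→ℚ (n ℕ.!) * ((tOverExpMinusOne ^S r) ⊛ expS x) n

-- Stirling numbers of the second kind:  (e^t-1)^m = m! Σ_l S_2(l,m) t^l / l!
stirling2 : ℕ → ℕ → ℚ
stirling2 l m = ℕ→ℚ (l ℕ.!) * inv! m * (expMinusOne ^S m) l

falling : ℕ → ℕ → ℕ
falling a zero    = 1
falling a (suc l) = falling a l ℕ.* (a ∸ l)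

module Submission where

-- Let P = Li_k(1-e^{-t})/(1-e^{-t}), E = e^{xt}, V = ((e^t-1)/t)^r and
-- T = (t/(e^t-1))^r, all formal power series over ℚ.  Since V·T = 1, the
-- commutativity and associativity of the Cauchy product give
--     P·E = (T·E)·(V·P).
-- Taking n! times the coefficient of t^n on both sides gives the theorem:
--     n! [t^n] (P·E)      = B_n^{(k)}(x),
--     m! [t^m] (T·E)      = 𝔹_m^{(r)}(x),
--     (n-m)! [t^{n-m}] (V·P) = Σ_l r! (n-m)_l / (l+r)! S₂(l+r,r) B_{n-m-l}^{(k)},
-- the last one because [t^l] V = [t^{l+r}] (e^t-1)^r = r!/(l+r)! S₂(l+r,r) and
-- [t^j] P = B_j^{(k)}/j!.

open import Defs
open import Data.Nat as ℕ using (ℕ; zero; suc; _∸_; _≤_; s≤s; _!)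
import Data.Nat.Properties as ℕP
open import Data.Nat.Combinatorics using (_C_; nCk≡n!/k![n-k]!; [n∸k]!k!∣n!)
open import Data.Nat.DivMod using (m/n*n≡m)
open import Data.Nat.Divisibility using (_∣_)
open import Data.Integer as ℤ using (ℤ)
import Data.Integer.Properties as ℤP
open import Data.Rational using (ℚ; _*_; _+_; -_; 0ℚ; 1ℚ; _/_; toℚᵘ)
import Data.Rational.Properties as ℚP
import Data.Rational.Unnormalised as ℚᵘ
import Data.Rational.Unnormalised.Properties as ℚᵘP
open import Data.Rational.Solver using (module +-*-Solver)
open import Data.List using (List)
open import Relation.Binary.PropositionalEquality
open ≡-Reasoning

Σ-cong : ∀ n {f g : ℕ → ℚ} → (∀ i → i ≤ n → f i ≡ g i) → Σ≤ n f ≡ Σ≤ n g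
Σ-cong zero    eq = eq 0 ℕ.z≤n
Σ-cong (suc n) eq =
  cong₂ _+_ (Σ-cong n λ i i≤n → eq i (ℕP.m≤n⇒m≤1+n i≤n)) (eq (suc n) ℕP.≤-refl)

Σ-+ : ∀ n (f g : ℕ → ℚ) → Σ≤ n (λ i → f i + g i) ≡ Σ≤ n f + Σ≤ n g
Σ-+ zero    f g = refl
Σ-+ (suc n) f g =
  trans (cong (_+ (f (suc n) + g (suc n))) (Σ-+ n f g)) (interchange (Σ≤ n f) (Σ≤ n g) (f (suc n)) (g (suc n)))
  where
  interchange : ∀ a b c d → (a + b) + (c + d) ≡ (a + c) + (b + d)
  interchange = solve 4 (λ a b c d → (a :+ b) :+ (c :+ d) := (a :+ c) :+ (b :+ d)) refl
    where open +-*-Solver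

Σ-*ˡ : ∀ n c (f : ℕ → ℚ) → Σ≤ n (λ i → c * f i) ≡ c * Σ≤ n f
Σ-*ˡ zero    c f = refl
Σ-*ˡ (suc n) c f = trans (cong (_+ c * f (suc n)) (Σ-*ˡ n c f))
                         (sym (ℚP.*-distribˡ-+ c (Σ≤ n f) (f (suc n))))

Σ-zero : ∀ n → Σ≤ n (λ _ → 0ℚ) ≡ 0ℚ
Σ-zero zero    = refl
Σ-zero (suc n) = cong (_+ 0ℚ) (Σ-zero n)

Σ-shift : ∀ n (f : ℕ → ℚ) → Σ≤ (suc n) f ≡ f 0 + Σ≤ n (λ i → f (suc i))
Σ-shift zero    f = refl
Σ-shift (suc n) f =
  trans (cong (_+ f (suc (suc n))) (Σ-shift n f)) (ℚP.+-assoc (f 0) _ _)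

sucn∸i : ∀ {n i} → i ≤ n → suc n ∸ i ≡ suc (n ∸ i)
sucn∸i i≤n = ℕP.+-∸-assoc 1 i≤n

∸-comm : ∀ a b c → a ∸ b ∸ c ≡ a ∸ c ∸ b
∸-comm a b c = begin
  a ∸ b ∸ c     ≡⟨ ℕP.∸-+-assoc a b c ⟩
  a ∸ (b ℕ.+ c) ≡⟨ cong (a ∸_) (ℕP.+-comm b c) ⟩
  a ∸ (c ℕ.+ b) ≡⟨ ℕP.∸-+-assoc a c b ⟨
  a ∸ c ∸ b     ∎

Σ-reverse : ∀ n (f : ℕ → ℚ) → Σ≤ n f ≡ Σ≤ n (λ i → f (n ∸ i))
Σ-reverse zero    f = refl
Σ-reverse (suc n) f = begin
  Σ≤ n f + f (suc n)                   ≡⟨ ℚP.+-comm (Σ≤ n f) _ ⟩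
  f (suc n) + Σ≤ n f                   ≡⟨ cong (f (suc n) +_) (Σ-reverse n f) ⟩
  f (suc n) + Σ≤ n (λ i → f (n ∸ i))   ≡⟨ Σ-shift n (λ i → f (suc n ∸ i)) ⟨
  Σ≤ (suc n) (λ i → f (suc n ∸ i))     ∎

-- The triangle {i + j ≤ n + 1} is the triangle {i + j ≤ n} plus the
-- anti-diagonal {i + j = n + 1}.
Σ-triangle-suc : ∀ n (F : ℕ → ℕ → ℚ) →
  Σ≤ (suc n) (λ i → Σ≤ (suc n ∸ i) (F i))
    ≡ Σ≤ n (λ i → Σ≤ (n ∸ i) (F i)) + Σ≤ (suc n) (λ i → F i (suc n ∸ i))
Σ-triangle-suc n F = begin
  Σ≤ n (λ i → Σ≤ (suc n ∸ i) (F i)) + Σ≤ (n ∸ n) (F (suc n))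
    ≡⟨ cong₂ _+_ (Σ-cong n λ i i≤n → cong (λ j → Σ≤ j (F i)) (sucn∸i i≤n))
                 (cong (λ j → Σ≤ j (F (suc n))) (ℕP.n∸n≡0 n)) ⟩
  Σ≤ n (λ i → Σ≤ (n ∸ i) (F i) + F i (suc (n ∸ i))) + F (suc n) 0
    ≡⟨ cong (_+ F (suc n) 0) (Σ-+ n _ _) ⟩
  (Δ + Σ≤ n (λ i → F i (suc (n ∸ i)))) + F (suc n) 0
    ≡⟨ ℚP.+-assoc Δ _ _ ⟩
  Δ + (Σ≤ n (λ i → F i (suc (n ∸ i))) + F (suc n) 0)
    ≡⟨ cong (Δ +_) (cong₂ _+_ (Σ-cong n λ i i≤n → cong (F i) (sym (sucn∸i i≤n)))
                              (cong (F (suc n)) (sym (ℕP.n∸n≡0 n)))) ⟩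
  Δ + Σ≤ (suc n) (λ i → F i (suc n ∸ i)) ∎
  where Δ = Σ≤ n (λ i → Σ≤ (n ∸ i) (F i))

Σ-triangle-swap : ∀ n (F : ℕ → ℕ → ℚ) →
  Σ≤ n (λ i → Σ≤ (n ∸ i) (λ j → F i j)) ≡ Σ≤ n (λ j → Σ≤ (n ∸ j) (λ i → F i j))
Σ-triangle-swap zero    F = refl
Σ-triangle-swap (suc n) F = begin
  Σ≤ (suc n) (λ i → Σ≤ (suc n ∸ i) (F i))
    ≡⟨ Σ-triangle-suc n F ⟩
  Σ≤ n (λ i → Σ≤ (n ∸ i) (F i)) + Σ≤ (suc n) (λ i → F i (suc n ∸ i))
    ≡⟨ cong₂ _+_ (Σ-triangle-swap n F) antidiagonal ⟩
  Σ≤ n (λ j → Σ≤ (n ∸ j) (λ i → F i j)) + Σ≤ (suc n) (λ j → F (suc n ∸ j) j)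
    ≡⟨ Σ-triangle-suc n (λ j i → F i j) ⟨
  Σ≤ (suc n) (λ j → Σ≤ (suc n ∸ j) (λ i → F i j)) ∎
  where
  antidiagonal : Σ≤ (suc n) (λ i → F i (suc n ∸ i)) ≡ Σ≤ (suc n) (λ j → F (suc n ∸ j) j)
  antidiagonal = trans (Σ-reverse (suc n) _)
    (Σ-cong (suc n) λ j j≤ → cong (F (suc n ∸ j)) (ℕP.m∸[m∸n]≡n j≤))

infix 4 _≗S_
_≗S_ : Series → Series → Set
f ≗S g = ∀ n → f n ≡ g n

infixr 5 _⟨≗⟩_
_⟨≗⟩_ : ∀ {f g h} → f ≗S g → g ≗S h → f ≗S h
(p ⟨≗⟩ q) n = trans (p n) (q n)

≗-sym : ∀ {f g} → f ≗S g → g ≗S f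
≗-sym p n = sym (p n)

⊛-comm : ∀ f g → f ⊛ g ≗S g ⊛ f
⊛-comm f g n = begin
  Σ≤ n (λ i → f i * g (n ∸ i))               ≡⟨ Σ-reverse n _ ⟩
  Σ≤ n (λ i → f (n ∸ i) * g (n ∸ (n ∸ i)))
    ≡⟨ Σ-cong n (λ i i≤n → trans (cong (λ j → f (n ∸ i) * g j) (ℕP.m∸[m∸n]≡n i≤n))
                                 (ℚP.*-comm (f (n ∸ i)) (g i))) ⟩
  Σ≤ n (λ i → g i * f (n ∸ i))               ∎

⊛-congˡ : ∀ {f g} h → f ≗S g → f ⊛ h ≗S g ⊛ h
⊛-congˡ h f≗g n = Σ-cong n λ i _ → cong (_* h (n ∸ i)) (f≗g i)

⊛-congʳ : ∀ f {g h} → g ≗S h → f ⊛ g ≗S f ⊛ h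
⊛-congʳ f g≗h n = Σ-cong n λ i _ → cong (f i *_) (g≗h (n ∸ i))

⊛-identityˡ : ∀ f → oneS ⊛ f ≗S f
⊛-identityˡ f zero    = ℚP.*-identityˡ (f 0)
⊛-identityˡ f (suc n) = begin
  Σ≤ (suc n) (λ i → oneS i * f (suc n ∸ i))         ≡⟨ Σ-shift n _ ⟩
  1ℚ * f (suc n) + Σ≤ n (λ i → 0ℚ * f (n ∸ i))
    ≡⟨ cong₂ _+_ (ℚP.*-identityˡ (f (suc n)))
                 (trans (Σ-cong n λ i _ → ℚP.*-zeroˡ (f (n ∸ i))) (Σ-zero n)) ⟩
  f (suc n) + 0ℚ                                    ≡⟨ ℚP.+-identityʳ _ ⟩
  f (suc n)                                         ∎

⊛-assoc : ∀ f g h → (f ⊛ g) ⊛ h ≗S f ⊛ (g ⊛ h)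
⊛-assoc f g h n = begin
  ((f ⊛ g) ⊛ h) n                                                  ≡⟨ ⊛-comm (f ⊛ g) h n ⟩
  Σ≤ n (λ i → h i * Σ≤ (n ∸ i) (λ j → f j * g (n ∸ i ∸ j)))
    ≡⟨ Σ-cong n (λ i _ → sym (Σ-*ˡ (n ∸ i) (h i) _)) ⟩
  Σ≤ n (λ i → Σ≤ (n ∸ i) (λ j → h i * (f j * g (n ∸ i ∸ j))))     ≡⟨ Σ-triangle-swap n _ ⟩
  Σ≤ n (λ j → Σ≤ (n ∸ j) (λ i → h i * (f j * g (n ∸ i ∸ j))))
    ≡⟨ Σ-cong n (λ j _ → Σ-cong (n ∸ j) λ i _ →
         trans (swap-front (h i) (f j) _) (cong (λ m → f j * (h i * g m)) (∸-comm n i j))) ⟩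
  Σ≤ n (λ j → Σ≤ (n ∸ j) (λ i → f j * (h i * g (n ∸ j ∸ i))))
    ≡⟨ Σ-cong n (λ j _ → Σ-*ˡ (n ∸ j) (f j) _) ⟩
  Σ≤ n (λ j → f j * (h ⊛ g) (n ∸ j))                               ≡⟨ ⊛-congʳ f (⊛-comm h g) n ⟩
  (f ⊛ (g ⊛ h)) n                                                  ∎
  where
  swap-front : ∀ a b c → a * (b * c) ≡ b * (a * c)
  swap-front = solve 3 (λ a b c → a :* (b :* c) := b :* (a :* c)) refl
    where open +-*-Solver

⊛-interchange : ∀ a b c d → (a ⊛ b) ⊛ (c ⊛ d) ≗S (a ⊛ c) ⊛ (b ⊛ d)
⊛-interchange a b c d =
  ⊛-assoc a b (c ⊛ d) ⟨≗⟩ ⊛-congʳ a (≗-sym (⊛-assoc b c d))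
  ⟨≗⟩ ⊛-congʳ a (⊛-congˡ d (⊛-comm b c)) ⟨≗⟩ ⊛-congʳ a (⊛-assoc c b d)
  ⟨≗⟩ ≗-sym (⊛-assoc a c (b ⊛ d))

^S-cong : ∀ {f g} r → f ≗S g → f ^S r ≗S g ^S r
^S-cong zero    f≗g n = refl
^S-cong {f} {g} (suc r) f≗g = ⊛-congˡ (f ^S r) f≗g ⟨≗⟩ ⊛-congʳ g (^S-cong r f≗g)

^S-⊛ : ∀ f g r → (f ⊛ g) ^S r ≗S (f ^S r) ⊛ (g ^S r)
^S-⊛ f g zero    = ≗-sym (⊛-identityˡ oneS)
^S-⊛ f g (suc r) = ⊛-congʳ (f ⊛ g) (^S-⊛ f g r) ⟨≗⟩ ⊛-interchange f g (f ^S r) (g ^S r)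

oneS-^S : ∀ r → oneS ^S r ≗S oneS
oneS-^S zero    n = refl
oneS-^S (suc r)   = ⊛-identityˡ (oneS ^S r) ⟨≗⟩ oneS-^S r

-- `invRev` indexes the list of coefficients computed so far with a function
-- that Defs keeps private.  Abstracting over `invRev f n` in `inv1S-unfold`
-- shows that function applied to a variable list, so unification determines
-- `lookup` to be it; its defining equations then hold by computation.
mutual
  lookup : List ℚ → ℕ → ℚ
  lookup = _

  inv1S-unfold : ∀ f n →
    inv1S f (suc n) ≡ - Σ≤ n (λ i → f (suc i) * lookup (invRev f n) i)
  inv1S-unfold f n with invRev f n
  ... | coefficients = refl

lookup-invRev : ∀ f n i → i ≤ n → lookup (invRev f n) i ≡ inv1S f (n ∸ i)
lookup-invRev f zero    zero    _         = refl
lookup-invRev f (suc n) zero    _         = refl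
lookup-invRev f (suc n) (suc i) (s≤s i≤n) = lookup-invRev f n i i≤n

inv1S-suc : ∀ f n → inv1S f (suc n) ≡ - Σ≤ n (λ i → f (suc i) * inv1S f (n ∸ i))
inv1S-suc f n = trans (inv1S-unfold f n)
  (cong -_ (Σ-cong n λ i i≤n → cong (f (suc i) *_) (lookup-invRev f n i i≤n)))

inv1S-inverseʳ : ∀ f → f 0 ≡ 1ℚ → f ⊛ inv1S f ≗S oneS
inv1S-inverseʳ f f₀≡1 zero    = cong (_* 1ℚ) f₀≡1
inv1S-inverseʳ f f₀≡1 (suc n) = begin
  Σ≤ (suc n) (λ i → f i * inv1S f (suc n ∸ i)) ≡⟨ Σ-shift n _ ⟩
  f 0 * inv1S f (suc n) + S                    ≡⟨ cong₂ (λ a b → a * b + S) f₀≡1 (inv1S-suc f n) ⟩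
  1ℚ * - S + S                                 ≡⟨ cong (_+ S) (ℚP.*-identityˡ (- S)) ⟩
  - S + S                                      ≡⟨ ℚP.+-inverseˡ S ⟩
  0ℚ                                           ∎
  where S = Σ≤ n (λ i → f (suc i) * inv1S f (n ∸ i))

mulT : Series → Series
mulT g zero    = 0ℚ
mulT g (suc n) = g n

mulTⁿ : ℕ → Series → Series
mulTⁿ zero    g = g
mulTⁿ (suc r) g = mulT (mulTⁿ r g)

mulT-cong : ∀ {f g} → f ≗S g → mulT f ≗S mulT g
mulT-cong f≗g zero    = refl
mulT-cong f≗g (suc n) = f≗g n

mulT-⊛ : ∀ f g → mulT f ⊛ g ≗S mulT (f ⊛ g)
mulT-⊛ f g zero    = ℚP.*-zeroˡ (g 0)
mulT-⊛ f g (suc n) = begin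
  Σ≤ (suc n) (λ i → mulT f i * g (suc n ∸ i)) ≡⟨ Σ-shift n _ ⟩
  0ℚ * g (suc n) + (f ⊛ g) n                  ≡⟨ cong (_+ (f ⊛ g) n) (ℚP.*-zeroˡ (g (suc n))) ⟩
  0ℚ + (f ⊛ g) n                              ≡⟨ ℚP.+-identityˡ _ ⟩
  (f ⊛ g) n                                   ∎

⊛-mulTⁿ : ∀ f r g → f ⊛ mulTⁿ r g ≗S mulTⁿ r (f ⊛ g)
⊛-mulTⁿ f zero    g n = refl
⊛-mulTⁿ f (suc r) g =
  ⊛-comm f (mulT (mulTⁿ r g)) ⟨≗⟩ mulT-⊛ (mulTⁿ r g) f
  ⟨≗⟩ mulT-cong (⊛-comm (mulTⁿ r g) f ⟨≗⟩ ⊛-mulTⁿ f r g)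

mulT-^S : ∀ f r → mulT f ^S r ≗S mulTⁿ r (f ^S r)
mulT-^S f zero    n = refl
mulT-^S f (suc r) =
  ⊛-congʳ (mulT f) (mulT-^S f r) ⟨≗⟩ mulT-⊛ f (mulTⁿ r (f ^S r))
  ⟨≗⟩ mulT-cong (⊛-mulTⁿ f r (f ^S r))

mulTⁿ-coeff : ∀ r g l → mulTⁿ r g (l ℕ.+ r) ≡ g l
mulTⁿ-coeff zero    g l = cong g (ℕP.+-identityʳ l)
mulTⁿ-coeff (suc r) g l = trans (cong (mulT (mulTⁿ r g)) (ℕP.+-suc l r)) (mulTⁿ-coeff r g l)

expMinusOne-^S-coeff : ∀ r l →
  (expMinusOne ^S r) (l ℕ.+ r) ≡ (expMinusOneOverT ^S r) l
expMinusOne-^S-coeff r l = begin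
  (expMinusOne ^S r) (l ℕ.+ r)                     ≡⟨ ^S-cong r e^t-1≗t·quotient (l ℕ.+ r) ⟩
  (mulT expMinusOneOverT ^S r) (l ℕ.+ r)           ≡⟨ mulT-^S expMinusOneOverT r (l ℕ.+ r) ⟩
  mulTⁿ r (expMinusOneOverT ^S r) (l ℕ.+ r)        ≡⟨ mulTⁿ-coeff r _ l ⟩
  (expMinusOneOverT ^S r) l                        ∎
  where
  e^t-1≗t·quotient : expMinusOne ≗S mulT expMinusOneOverT
  e^t-1≗t·quotient zero    = refl
  e^t-1≗t·quotient (suc n) = refl

-- Identities of ℚ are checked on unnormalised representatives.
ℕ→ℚ-toℚᵘ : ∀ n → toℚᵘ (ℕ→ℚ n) ℚᵘ.≃ ℚᵘ.mkℚᵘ (ℤ.+ n) 0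
ℕ→ℚ-toℚᵘ n = ℚP.toℚᵘ-fromℚᵘ (ℚᵘ.mkℚᵘ (ℤ.+ n) 0)

ℕ→ℚ-* : ∀ a b → ℕ→ℚ (a ℕ.* b) ≡ ℕ→ℚ a * ℕ→ℚ b
ℕ→ℚ-* a b = ℚP.toℚᵘ-injective
  (ℚᵘP.≃-trans (ℕ→ℚ-toℚᵘ (a ℕ.* b))
  (ℚᵘP.≃-trans product-of-integers
  (ℚᵘP.≃-sym (ℚᵘP.≃-trans (ℚP.toℚᵘ-homo-* (ℕ→ℚ a) (ℕ→ℚ b))
                          (ℚᵘP.*-cong (ℕ→ℚ-toℚᵘ a) (ℕ→ℚ-toℚᵘ b))))))
  where
  product-of-integers : ℚᵘ.mkℚᵘ (ℤ.+ (a ℕ.* b)) 0 ℚᵘ.≃ ℚᵘ.mkℚᵘ (ℤ.+ a) 0 ℚᵘ.* ℚᵘ.mkℚᵘ (ℤ.+ b) 0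
  product-of-integers = ℚᵘ.*≡* (cong (ℤ._* ℤ.+ 1) (ℤP.pos-* a b))

ℕ→ℚ-*-recip : ∀ d .{{_ : ℕ.NonZero d}} → ℕ→ℚ d * (ℤ.+ 1 / d) ≡ 1ℚ
ℕ→ℚ-*-recip (suc d) = ℚP.toℚᵘ-injective
  (ℚᵘP.≃-trans (ℚP.toℚᵘ-homo-* (ℕ→ℚ (suc d)) _)
  (ℚᵘP.≃-trans (ℚᵘP.*-cong (ℕ→ℚ-toℚᵘ (suc d)) (ℚP.toℚᵘ-fromℚᵘ (ℚᵘ.mkℚᵘ (ℤ.+ 1) d)))
               (ℚᵘ.*≡* cross)))
  where
  cross : ℤ.+ suc d ℤ.* ℤ.+ 1 ℤ.* ℤ.+ 1 ≡ ℤ.+ 1 ℤ.* ℤ.+ (1 ℕ.* suc d)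
  cross = begin
    ℤ.+ suc d ℤ.* ℤ.+ 1 ℤ.* ℤ.+ 1  ≡⟨ ℤP.*-identityʳ _ ⟩
    ℤ.+ suc d ℤ.* ℤ.+ 1            ≡⟨ ℤP.*-identityʳ _ ⟩
    ℤ.+ suc d                      ≡⟨ cong ℤ.+_ (ℕP.*-identityˡ (suc d)) ⟨
    ℤ.+ (1 ℕ.* suc d)              ≡⟨ ℤP.*-identityˡ _ ⟨
    ℤ.+ 1 ℤ.* ℤ.+ (1 ℕ.* suc d)    ∎

ℕ→ℚ-!-inv! : ∀ n → ℕ→ℚ (n !) * inv! n ≡ 1ℚ
ℕ→ℚ-!-inv! n = ℕ→ℚ-*-recip (n !) {{n ℕP.!≢0}}

binomial-factorials : ∀ n m → m ≤ n → (n C m) ℕ.* (m ! ℕ.* (n ∸ m) !) ≡ n !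
binomial-factorials n m m≤n =
  trans (cong (ℕ._* (m ! ℕ.* (n ∸ m) !)) (nCk≡n!/k![n-k]! m≤n))
        (m/n*n≡m {{m ℕP.!* (n ∸ m) !≢0}} m![n∸m]!∣n!)
  where
  m![n∸m]!∣n! : m ! ℕ.* (n ∸ m) ! ∣ n !
  m![n∸m]!∣n! = subst (_∣ n !) (ℕP.*-comm ((n ∸ m) !) (m !)) ([n∸k]!k!∣n! m≤n)

falling-factorial : ∀ a l → l ≤ a → falling a l ℕ.* (a ∸ l) ! ≡ a !
falling-factorial a zero    _    = ℕP.*-identityˡ (a !)
falling-factorial a (suc l) l<a@(s≤s l≤a′) = begin
  falling a l ℕ.* (a ∸ l) ℕ.* (a ∸ suc l) !   ≡⟨ ℕP.*-assoc (falling a l) _ _ ⟩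
  falling a l ℕ.* ((a ∸ l) ℕ.* (a ∸ suc l) !) ≡⟨ cong (falling a l ℕ.*_) peel ⟩
  falling a l ℕ.* (a ∸ l) !                   ≡⟨ falling-factorial a l (ℕP.<⇒≤ l<a) ⟩
  a !                                         ∎
  where
  peel : (a ∸ l) ℕ.* (a ∸ suc l) ! ≡ (a ∸ l) !
  peel rewrite sucn∸i l≤a′ = refl

expS-zero : expS 0ℚ ≗S oneS
expS-zero zero    = refl
expS-zero (suc n) = trans (cong (_* inv! (suc n)) (ℚP.*-zeroˡ (0ℚ ^ℚ n))) (ℚP.*-zeroˡ (inv! (suc n)))

module Coefficients (k : ℤ) (r : ℕ) (x : ℚ) where
  P E V T : Series
  P = polyLiQuot k
  E = expS x
  V = expMinusOneOverT ^S r
  T = tOverExpMinusOne ^S r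

  polyBernoulli-coeff : ∀ j → polyBernoulli k j ≡ ℕ→ℚ (j !) * P j
  polyBernoulli-coeff j = cong (ℕ→ℚ (j !) *_)
    ((⊛-congʳ P expS-zero ⟨≗⟩ ⊛-comm P oneS ⟨≗⟩ ⊛-identityˡ P) j)

  stirling2-coeff : ∀ l → stirling2 (l ℕ.+ r) r ≡ ℕ→ℚ ((l ℕ.+ r) !) * inv! r * V l
  stirling2-coeff l = cong (ℕ→ℚ ((l ℕ.+ r) !) * inv! r *_) (expMinusOne-^S-coeff r l)

  -- (e^t-1)/t has constant term 1, so T = (1/((e^t-1)/t))^r inverts V.
  V⊛T≗1 : V ⊛ T ≗S oneS
  V⊛T≗1 = ≗-sym (^S-⊛ expMinusOneOverT tOverExpMinusOne r)
    ⟨≗⟩ ^S-cong r (inv1S-inverseʳ expMinusOneOverT refl) ⟨≗⟩ oneS-^S r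

  generating-identity : (T ⊛ E) ⊛ (V ⊛ P) ≗S P ⊛ E
  generating-identity = ⊛-comm (T ⊛ E) (V ⊛ P) ⟨≗⟩ ⊛-interchange V P T E
    ⟨≗⟩ ⊛-congˡ (P ⊛ E) V⊛T≗1 ⟨≗⟩ ⊛-identityˡ (P ⊛ E)

  inner-term : ∀ a l → l ≤ a →
    ℕ→ℚ (r ! ℕ.* falling a l) * inv! (l ℕ.+ r) * stirling2 (l ℕ.+ r) r
      * polyBernoulli k (a ∸ l)
    ≡ ℕ→ℚ (a !) * (V l * P (a ∸ l))
  inner-term a l l≤a = begin
    ℕ→ℚ (r ! ℕ.* falling a l) * inv! (l ℕ.+ r) * stirling2 (l ℕ.+ r) r
      * polyBernoulli k (a ∸ l)
      ≡⟨ cong₂ (λ u v → u * inv! (l ℕ.+ r) * v * polyBernoulli k (a ∸ l))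
               (ℕ→ℚ-* (r !) (falling a l)) (stirling2-coeff l) ⟩
    r!′ * ℕ→ℚ (falling a l) * inv! (l ℕ.+ r) * ([l+r]!′ * inv! r * V l)
      * polyBernoulli k (a ∸ l)
      ≡⟨ cong (r!′ * ℕ→ℚ (falling a l) * inv! (l ℕ.+ r) * ([l+r]!′ * inv! r * V l) *_)
              (polyBernoulli-coeff (a ∸ l)) ⟩
    r!′ * ℕ→ℚ (falling a l) * inv! (l ℕ.+ r) * ([l+r]!′ * inv! r * V l)
      * (ℕ→ℚ ((a ∸ l) !) * P (a ∸ l))
      ≡⟨ regroup r!′ (ℕ→ℚ (falling a l)) (inv! (l ℕ.+ r)) [l+r]!′ (inv! r) (V l)
                 (ℕ→ℚ ((a ∸ l) !)) (P (a ∸ l)) ⟩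
    (r!′ * inv! r) * ([l+r]!′ * inv! (l ℕ.+ r))
      * (ℕ→ℚ (falling a l) * ℕ→ℚ ((a ∸ l) !) * (V l * P (a ∸ l)))
      ≡⟨ cong₂ (λ u v → u * v * (ℕ→ℚ (falling a l) * ℕ→ℚ ((a ∸ l) !) * (V l * P (a ∸ l))))
               (ℕ→ℚ-!-inv! r) (ℕ→ℚ-!-inv! (l ℕ.+ r)) ⟩
    1ℚ * 1ℚ * (ℕ→ℚ (falling a l) * ℕ→ℚ ((a ∸ l) !) * (V l * P (a ∸ l)))
      ≡⟨ ℚP.*-identityˡ _ ⟩
    ℕ→ℚ (falling a l) * ℕ→ℚ ((a ∸ l) !) * (V l * P (a ∸ l))
      ≡⟨ cong (_* (V l * P (a ∸ l)))
              (trans (sym (ℕ→ℚ-* (falling a l) ((a ∸ l) !)))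
                     (cong ℕ→ℚ (falling-factorial a l l≤a))) ⟩
    ℕ→ℚ (a !) * (V l * P (a ∸ l)) ∎
    where
    r!′ [l+r]!′ : ℚ
    r!′ = ℕ→ℚ (r !)
    [l+r]!′ = ℕ→ℚ ((l ℕ.+ r) !)
    regroup : ∀ a b c d e v g p →
      a * b * c * (d * e * v) * (g * p) ≡ (a * e) * (d * c) * (b * g * (v * p))
    regroup = solve 8 (λ a b c d e v g p →
      a :* b :* c :* (d :* e :* v) :* (g :* p) := (a :* e) :* (d :* c) :* (b :* g :* (v :* p))) refl
      where open +-*-Solver

  outer-term : ∀ n m → m ≤ n →
    ℕ→ℚ (n C m) *
      Σ≤ (n ∸ m) (λ l →
        ℕ→ℚ (r ! ℕ.* falling (n ∸ m) l) * inv! (l ℕ.+ r)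
          * stirling2 (l ℕ.+ r) r
          * polyBernoulli k (n ∸ l ∸ m))
      * bernoulliPolyOrder r m x
    ≡ ℕ→ℚ (n !) * ((T ⊛ E) m * (V ⊛ P) (n ∸ m))
  outer-term n m m≤n = begin
    ℕ→ℚ (n C m) * Σ≤ (n ∸ m) _ * bernoulliPolyOrder r m x
      ≡⟨ cong (λ s → ℕ→ℚ (n C m) * s * bernoulliPolyOrder r m x) inner-sum ⟩
    ℕ→ℚ (n C m) * (ℕ→ℚ ((n ∸ m) !) * (V ⊛ P) (n ∸ m)) * (ℕ→ℚ (m !) * (T ⊛ E) m)
      ≡⟨ regroup (ℕ→ℚ (n C m)) (ℕ→ℚ ((n ∸ m) !)) ((V ⊛ P) (n ∸ m)) (ℕ→ℚ (m !)) ((T ⊛ E) m) ⟩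
    ℕ→ℚ (n C m) * (ℕ→ℚ (m !) * ℕ→ℚ ((n ∸ m) !)) * ((T ⊛ E) m * (V ⊛ P) (n ∸ m))
      ≡⟨ cong (_* ((T ⊛ E) m * (V ⊛ P) (n ∸ m))) factorials ⟩
    ℕ→ℚ (n !) * ((T ⊛ E) m * (V ⊛ P) (n ∸ m)) ∎
    where
    inner-sum : Σ≤ (n ∸ m) (λ l →
                  ℕ→ℚ (r ! ℕ.* falling (n ∸ m) l) * inv! (l ℕ.+ r)
                    * stirling2 (l ℕ.+ r) r * polyBernoulli k (n ∸ l ∸ m))
              ≡ ℕ→ℚ ((n ∸ m) !) * (V ⊛ P) (n ∸ m)
    inner-sum = trans
      (Σ-cong (n ∸ m) λ l l≤ → trans
        (cong (λ j → ℕ→ℚ (r ! ℕ.* falling (n ∸ m) l) * inv! (l ℕ.+ r)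
                       * stirling2 (l ℕ.+ r) r * polyBernoulli k j) (∸-comm n l m))
        (inner-term (n ∸ m) l l≤))
      (Σ-*ˡ (n ∸ m) (ℕ→ℚ ((n ∸ m) !)) _)
    factorials : ℕ→ℚ (n C m) * (ℕ→ℚ (m !) * ℕ→ℚ ((n ∸ m) !)) ≡ ℕ→ℚ (n !)
    factorials = begin
      ℕ→ℚ (n C m) * (ℕ→ℚ (m !) * ℕ→ℚ ((n ∸ m) !)) ≡⟨ cong (ℕ→ℚ (n C m) *_) (ℕ→ℚ-* (m !) _) ⟨
      ℕ→ℚ (n C m) * ℕ→ℚ (m ! ℕ.* (n ∸ m) !)       ≡⟨ ℕ→ℚ-* (n C m) _ ⟨
      ℕ→ℚ ((n C m) ℕ.* (m ! ℕ.* (n ∸ m) !))        ≡⟨ cong ℕ→ℚ (binomial-factorials n m m≤n) ⟩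
      ℕ→ℚ (n !)                                    ∎
    regroup : ∀ c f y g w → c * (f * y) * (g * w) ≡ c * (g * f) * (w * y)
    regroup = solve 5 (λ c f y g w → c :* (f :* y) :* (g :* w) := c :* (g :* f) :* (w :* y)) refl
      where open +-*-Solver

theorem4 : (k : ℤ) (r n : ℕ) (x : ℚ) →
    polyBernoulliPoly k n x ≡
      Σ≤ n (λ m →
        (ℕ→ℚ (n C m) *
          Σ≤ (n ∸ m) (λ l →
            ℕ→ℚ (r ℕ.! ℕ.* falling (n ∸ m) l) * inv! (l ℕ.+ r)
              * stirling2 (l ℕ.+ r) r
              * polyBernoulli k (n ∸ l ∸ m)))
        * bernoulliPolyOrder r m x)
theorem4 k r n x = sym (begin
  Σ≤ n _                                               ≡⟨ Σ-cong n (outer-term n) ⟩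
  Σ≤ n (λ m → ℕ→ℚ (n !) * ((T ⊛ E) m * (V ⊛ P) (n ∸ m)))
                                                       ≡⟨ Σ-*ˡ n (ℕ→ℚ (n !)) _ ⟩
  ℕ→ℚ (n !) * ((T ⊛ E) ⊛ (V ⊛ P)) n                    ≡⟨ cong (ℕ→ℚ (n !) *_) (generating-identity n) ⟩
  polyBernoulliPoly k n x                              ∎)
  where open Coefficients k r x
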